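{- For non-negative integers $A,B$ and $D\in\{0,1\}$, let Bernstein's binary differential addition chain $C_D(A,B)$ be as defined in the context. Suppose $A,B\ge0$, $D\in\{0,1\}$, let $a=\lfloor A/2\rfloor$, $b=\lfloor B/2\rfloor$, with $d$ as in the context, and suppose $(a,b)\neq(0,0)$. Write $C_D(A,B)=(\ldots,o,e,m,O,E,M)$, i.e. $(o,e,m)$ are the last three terms of $C_d(a,b)$ and $(O,E,M)$ the last three terms of $C_D(A,B)$. Then, with all congruences modulo $2$ and all pairs in $\mathbb{Z}^2$: (i) $O=o+e$, and $o-e=\pm(1,1)$ if $A\equiv B$, while $o-e=\pm(1,-1)$ if $A\not\equiv B$; (ii) $E=2e$ if $A\equiv a$ and $B\equiv b$; $E=2m$ if exactly one of $A\equiv a$, $B\equiv b$ holds; $E=2o$ if $A\not\equiv a$ and $B\not\equiv b$; (iii) writing $(\alpha,\beta')=(A-a\bmod 2,\,B-b\bmod 2)$: $M=m+e$ when $(\alpha,\beta',D)\in\{(0,0,0),(0,0,1),(0,1,0),(1,0,1)\}$, and $M=m+o$ when $(\alpha,\beta',D)\in\{(0,1,1),(1,0,0),(1,1,0),(1,1,1)\}$; moreover the difference of the two summands of $M$ (i.e. $m-e$, resp. $m-o$) equals $\pm(0,1)$ if $D=0$ and $\pm(1,0)$ if $D=1$.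
   Context: Bernstein's binary differential addition chain is defined recursively as follows. Set $C_0(0,0)=C_1(0,0)=((0,0),(1,0),(0,1),(1,-1))$. For $(A,B)\neq(0,0)$ with $A,B\ge0$ and $D\in\{0,1\}$, define $C_D(A,B)=C_d(a,b)\,\|\,(O,E,M)$, where $\|$ denotes concatenation of sequences, $O=(A+(A+1\bmod 2),\,B+(B+1\bmod 2))$, $E=(A+(A\bmod 2),\,B+(B\bmod 2))$, $M=(A+(A+D\bmod 2),\,B+(B+D+1\bmod 2))$ (here $k\bmod 2\in\{0,1\}$), $a=\lfloor A/2\rfloor$, $b=\lfloor B/2\rfloor$, and $d=D$ if $a\equiv A$ and $b\equiv B\pmod 2$; $d=0$ if $a\equiv A$ and $b\not\equiv B$; $d=1$ if $a\not\equiv A$ and $b\equiv B$; $d=1-D$ if $a\not\equiv A$ and $b\not\equiv B$. -}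

module Defs where

open import Data.Nat using (ℕ; zero; suc; _+_; _∸_; _≡ᵇ_)
open import Data.Nat.DivMod using (_/_; _%_)
open import Data.Bool using (Bool; true; false; if_then_else_; _∧_)
open import Data.Integer using (ℤ; +_; 0ℤ; 1ℤ; -1ℤ) renaming (_+_ to _+ℤ_; _-_ to _-ℤ_; -_ to -ℤ_)
open import Data.Product using (_×_; _,_)
open import Data.List using (List; []; _∷_; _++_)
open import Data.Sum using (_⊎_)
open import Relation.Binary.PropositionalEquality using (_≡_)

ℤ² : Set
ℤ² = ℤ × ℤ

nat² : ℕ → ℕ → ℤ²
nat² x y = (+ x , + y)

_⊕_ : ℤ² → ℤ² → ℤ²
(x₁ , y₁) ⊕ (x₂ , y₂) = (x₁ +ℤ x₂ , y₁ +ℤ y₂)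

_⊖_ : ℤ² → ℤ² → ℤ²
(x₁ , y₁) ⊖ (x₂ , y₂) = (x₁ -ℤ x₂ , y₁ -ℤ y₂)

neg² : ℤ² → ℤ²
neg² (x , y) = (-ℤ x , -ℤ y)

two· : ℤ² → ℤ²
two· v = v ⊕ v

_≡±_ : ℤ² → ℤ² → Set
u ≡± v = (u ≡ v) ⊎ (u ≡ neg² v)

termO termE termM : ℕ → ℕ → ℕ → ℤ²
termO D A B = nat² (A + (A + 1) % 2) (B + (B + 1) % 2)
termE D A B = nat² (A + A % 2) (B + B % 2)
termM D A B = nat² (A + (A + D) % 2) (B + (B + D + 1) % 2)

nextD : ℕ → ℕ → ℕ → ℕ
nextD D A B with (A % 2) ≡ᵇ ((A / 2) % 2) | (B % 2) ≡ᵇ ((B / 2) % 2)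
... | true  | true  = D
... | true  | false = 0
... | false | true  = 1
... | false | false = 1 ∸ D

baseChain : List ℤ²
baseChain = (0ℤ , 0ℤ) ∷ (1ℤ , 0ℤ) ∷ (0ℤ , 1ℤ) ∷ (1ℤ , -1ℤ) ∷ []

-- Fuel-driven version of the recursion; A + B strictly decreases at each
-- recursive step when (A,B) ≠ (0,0), so fuel suc (A + B) is always enough.
chainF : ℕ → ℕ → ℕ → ℕ → List ℤ²
chainF zero    D A B = baseChain
chainF (suc k) D A B =
  if (A ≡ᵇ 0) ∧ (B ≡ᵇ 0)
  then baseChain
  else chainF k (nextD D A B) (A / 2) (B / 2)
         ++ (termO D A B ∷ termE D A B ∷ termM D A B ∷ [])

chain : ℕ → ℕ → ℕ → List ℤ²
chain D A B = chainF (suc (A + B)) D A B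

⟨_,_,_⟩ : ℕ → ℕ → ℕ → ℕ × ℕ × ℕ
⟨ x , y , z ⟩ = (x , y , z)

-- Everything happens coordinatewise. For n = 2a + r with r ∈ {0,1}, the odd element of {n, n+1}
-- is 2a + 1, the sum of the odd and the even element of {a, a+1}: this is O = o + e. The even
-- element of {n, n+1} is 2(a + r), twice the even or the odd element of {a, a+1} according as
-- r ≡ a (mod 2) or not: this is (ii). The odd and even elements of {a, a+1} differ by (−1)^a,
-- which gives the differences in (i). For (iii), D decides which of A, B alone determines the
-- bit d, and in each listed case m agrees with the other summand in one coordinate (where M is
-- twice it) and is the complementary element of its pair in the other (where M is their sum).

module Submission where

open import Defs
open import Data.Nat using (ℕ; zero; suc; _+_; _*_; _∸_; _<_; _≡ᵇ_; s≤s)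
open import Data.Nat.Properties using (+-comm; +-identityʳ; +-assoc; +-suc; m+n∸n≡m; m≢1+n+m; ≡ᵇ⇒≡; ≡⇒≡ᵇ)
open import Data.Nat.DivMod using (_/_; _%_; m≡m%n+[m/n]*n; m%n<n; m%n%n≡m%n; %-distribˡ-+; [m+n]%n≡m%n)
open import Data.Nat.Tactic.RingSolver using (solve-∀)
open import Data.Integer using (ℤ; +_; 0ℤ; 1ℤ; -1ℤ) renaming (_+_ to _ℤ+_; _-_ to _-ℤ_)
open import Data.Integer.Properties using (+-inverseʳ)
import Data.Integer.Tactic.RingSolver as ℤ-Solver
open import Data.Bool using (true; false)
open import Data.Bool.Properties using (T-≡; ¬-not)
open import Data.Product using (_×_; _,_; ∃)
open import Data.Sum using (_⊎_; inj₁; inj₂; swap)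
open import Data.List using (List; []; _∷_; _++_; length)
open import Data.List.Properties using (∷-injectiveʳ; length-++; ++-assoc)
open import Function.Bundles using (Equivalence)
open import Relation.Binary.PropositionalEquality using (_≡_; _≢_; refl; sym; trans; cong; cong₂; module ≡-Reasoning)
open import Relation.Nullary using (¬_; contradiction)

open ≡-Reasoning

++-cancelˡ-≡length : ∀ {X : Set} (xs ys : List X) {us vs : List X} →
  length us ≡ length vs → xs ++ us ≡ ys ++ vs → us ≡ vs
++-cancelˡ-≡length []       []       _ eq = eq
++-cancelˡ-≡length (x ∷ xs) (y ∷ ys) l eq = ++-cancelˡ-≡length xs ys l (∷-injectiveʳ eq)
++-cancelˡ-≡length []       (y ∷ ys) {vs = vs} l eq =
  contradiction (trans (sym l) (trans (cong length eq) (length-++ (y ∷ ys)))) (m≢1+n+m (length vs))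
++-cancelˡ-≡length (x ∷ xs) []       l eq = sym (++-cancelˡ-≡length [] (x ∷ xs) (sym l) (sym eq))

≡⇒≡ᵇ≡true : ∀ {m n} → m ≡ n → (m ≡ᵇ n) ≡ true
≡⇒≡ᵇ≡true {m} {n} m≡n = Equivalence.to T-≡ (≡⇒≡ᵇ m n m≡n)

≢⇒≡ᵇ≡false : ∀ {m n} → m ≢ n → (m ≡ᵇ n) ≡ false
≢⇒≡ᵇ≡false {m} {n} m≢n = ¬-not (λ eq → m≢n (≡ᵇ⇒≡ m n (Equivalence.from T-≡ eq)))

⟨⟩-injective : ∀ {x y z u v w} → ⟨ x , y , z ⟩ ≡ ⟨ u , v , w ⟩ → x ≡ u × y ≡ v × z ≡ w
⟨⟩-injective refl = refl , refl , refl

Bit : ℕ → Set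
Bit r = r ≡ 0 ⊎ r ≡ 1

%2-bit : ∀ n → Bit (n % 2)
%2-bit n with n % 2 | m%n<n n 2
... | 0           | _            = inj₁ refl
... | 1           | _            = inj₂ refl
... | suc (suc _) | s≤s (s≤s ())

bit+[bit+1]%2≡1 : ∀ {r} → Bit r → r + (r + 1) % 2 ≡ 1
bit+[bit+1]%2≡1 (inj₁ refl) = refl
bit+[bit+1]%2≡1 (inj₂ refl) = refl

bit≢⇒≡[bit+1]%2 : ∀ {r s} → Bit r → Bit s → r ≢ s → r ≡ (s + 1) % 2
bit≢⇒≡[bit+1]%2 (inj₁ refl) (inj₁ refl) r≢s = contradiction refl r≢s
bit≢⇒≡[bit+1]%2 (inj₁ refl) (inj₂ refl) _   = refl
bit≢⇒≡[bit+1]%2 (inj₂ refl) (inj₁ refl) _   = refl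
bit≢⇒≡[bit+1]%2 (inj₂ refl) (inj₂ refl) r≢s = contradiction refl r≢s

[bit+bit]%2≡0⇒≡ : ∀ {r s} → Bit r → Bit s → (r + s) % 2 ≡ 0 → r ≡ s
[bit+bit]%2≡0⇒≡ (inj₁ refl) (inj₁ refl) _  = refl
[bit+bit]%2≡0⇒≡ (inj₁ refl) (inj₂ refl) ()
[bit+bit]%2≡0⇒≡ (inj₂ refl) (inj₁ refl) ()
[bit+bit]%2≡0⇒≡ (inj₂ refl) (inj₂ refl) _  = refl

[bit+bit]%2≡1⇒≢ : ∀ {r s} → Bit r → Bit s → (r + s) % 2 ≡ 1 → r ≢ s
[bit+bit]%2≡1⇒≢ (inj₁ refl) (inj₁ refl) ()
[bit+bit]%2≡1⇒≢ (inj₁ refl) (inj₂ refl) _ ()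
[bit+bit]%2≡1⇒≢ (inj₂ refl) (inj₁ refl) _ ()
[bit+bit]%2≡1⇒≢ (inj₂ refl) (inj₂ refl) ()

[m+n]%2≡[m%2+n%2]%2 : ∀ m n → (m + n) % 2 ≡ (m % 2 + n % 2) % 2
[m+n]%2≡[m%2+n%2]%2 m n = %-distribˡ-+ m n 2

n%2+[n+1]%2≡1 : ∀ n → n % 2 + (n + 1) % 2 ≡ 1
n%2+[n+1]%2≡1 n = trans (cong (_+_ (n % 2)) ([m+n]%2≡[m%2+n%2]%2 n 1)) (bit+[bit+1]%2≡1 (%2-bit n))

%2≢⇒≡[1+]%2 : ∀ m n → m % 2 ≢ n % 2 → m % 2 ≡ (n + 1) % 2
%2≢⇒≡[1+]%2 m n m≢n =
  trans (bit≢⇒≡[bit+1]%2 (%2-bit m) (%2-bit n) m≢n) (sym ([m+n]%2≡[m%2+n%2]%2 n 1))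

LowBitsAgree : ℕ → Set
LowBitsAgree n = n % 2 ≡ (n / 2) % 2

n∸n/2≡n%2+n/2 : ∀ n → n ∸ n / 2 ≡ n % 2 + n / 2
n∸n/2≡n%2+n/2 n = begin
  n ∸ n / 2                      ≡⟨ cong (λ x → x ∸ n / 2) (m≡m%n+[m/n]*n n 2) ⟩
  n % 2 + n / 2 * 2 ∸ n / 2      ≡⟨ cong (λ x → x ∸ n / 2) (regroup (n % 2) (n / 2)) ⟩
  n % 2 + n / 2 + n / 2 ∸ n / 2  ≡⟨ m+n∸n≡m (n % 2 + n / 2) (n / 2) ⟩
  n % 2 + n / 2                  ∎
  where
  regroup : ∀ r a → r + a * 2 ≡ r + a + a
  regroup = solve-∀

[n∸n/2]%2≡[n%2+[n/2]%2]%2 : ∀ n → (n ∸ n / 2) % 2 ≡ (n % 2 + (n / 2) % 2) % 2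
[n∸n/2]%2≡[n%2+[n/2]%2]%2 n = begin
  (n ∸ n / 2) % 2                ≡⟨ cong (_% 2) (n∸n/2≡n%2+n/2 n) ⟩
  (n % 2 + n / 2) % 2            ≡⟨ [m+n]%2≡[m%2+n%2]%2 (n % 2) (n / 2) ⟩
  (n % 2 % 2 + (n / 2) % 2) % 2  ≡⟨ cong (λ r → (r + (n / 2) % 2) % 2) (m%n%n≡m%n n 2) ⟩
  (n % 2 + (n / 2) % 2) % 2      ∎

[n∸n/2]%2≡0⇒agree : ∀ n → (n ∸ n / 2) % 2 ≡ 0 → LowBitsAgree n
[n∸n/2]%2≡0⇒agree n h =
  [bit+bit]%2≡0⇒≡ (%2-bit n) (%2-bit (n / 2)) (trans (sym ([n∸n/2]%2≡[n%2+[n/2]%2]%2 n)) h)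

[n∸n/2]%2≡1⇒disagree : ∀ n → (n ∸ n / 2) % 2 ≡ 1 → ¬ LowBitsAgree n
[n∸n/2]%2≡1⇒disagree n h =
  [bit+bit]%2≡1⇒≢ (%2-bit n) (%2-bit (n / 2)) (trans (sym ([n∸n/2]%2≡[n%2+[n/2]%2]%2 n)) h)

-- termO D A B and termE D A B are definitionally nat² (roundOdd A) (roundOdd B)
-- and nat² (roundEven A) (roundEven B).
roundEven roundOdd : ℕ → ℕ
roundEven n = n + n % 2
roundOdd  n = n + (n + 1) % 2

roundOdd+roundEven≡1+n*2 : ∀ n → roundOdd n + roundEven n ≡ suc (n * 2)
roundOdd+roundEven≡1+n*2 n = begin
  n + (n + 1) % 2 + (n + n % 2)  ≡⟨ regroup n ((n + 1) % 2) (n % 2) ⟩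
  n * 2 + (n % 2 + (n + 1) % 2)  ≡⟨ cong (_+_ (n * 2)) (n%2+[n+1]%2≡1 n) ⟩
  n * 2 + 1                      ≡⟨ +-comm (n * 2) 1 ⟩
  suc (n * 2)                    ∎
  where
  regroup : ∀ n p q → n + p + (n + q) ≡ n * 2 + (q + p)
  regroup = solve-∀

roundOdd≡1+[n/2]*2 : ∀ n → roundOdd n ≡ suc (n / 2 * 2)
roundOdd≡1+[n/2]*2 n = begin
  n + (n + 1) % 2                        ≡⟨ cong (λ x → x + (n + 1) % 2) (m≡m%n+[m/n]*n n 2) ⟩
  n % 2 + n / 2 * 2 + (n + 1) % 2        ≡⟨ regroup (n % 2) (n / 2) ((n + 1) % 2) ⟩
  n / 2 * 2 + (n % 2 + (n + 1) % 2)      ≡⟨ cong (_+_ (n / 2 * 2)) (n%2+[n+1]%2≡1 n) ⟩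
  n / 2 * 2 + 1                          ≡⟨ +-comm (n / 2 * 2) 1 ⟩
  suc (n / 2 * 2)                        ∎
  where
  regroup : ∀ r a p → r + a * 2 + p ≡ a * 2 + (r + p)
  regroup = solve-∀

roundOdd-halve : ∀ n → roundOdd n ≡ roundOdd (n / 2) + roundEven (n / 2)
roundOdd-halve n = trans (roundOdd≡1+[n/2]*2 n) (sym (roundOdd+roundEven≡1+n*2 (n / 2)))

roundEven≡double[n/2+n%2] : ∀ n → roundEven n ≡ (n / 2 + n % 2) + (n / 2 + n % 2)
roundEven≡double[n/2+n%2] n = begin
  n + n % 2                      ≡⟨ cong (λ x → x + n % 2) (m≡m%n+[m/n]*n n 2) ⟩
  n % 2 + n / 2 * 2 + n % 2      ≡⟨ regroup (n % 2) (n / 2) ⟩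
  (n / 2 + n % 2) + (n / 2 + n % 2) ∎
  where
  regroup : ∀ r a → r + a * 2 + r ≡ (a + r) + (a + r)
  regroup = solve-∀

roundEven-halve-agree : ∀ n → LowBitsAgree n → roundEven n ≡ roundEven (n / 2) + roundEven (n / 2)
roundEven-halve-agree n h =
  trans (roundEven≡double[n/2+n%2] n) (cong (λ r → (n / 2 + r) + (n / 2 + r)) h)

roundEven-halve-disagree : ∀ n → ¬ LowBitsAgree n → roundEven n ≡ roundOdd (n / 2) + roundOdd (n / 2)
roundEven-halve-disagree n h =
  trans (roundEven≡double[n/2+n%2] n) (cong (λ r → (n / 2 + r) + (n / 2 + r)) (%2≢⇒≡[1+]%2 n (n / 2) h))

roundOdd-even : ∀ n → n % 2 ≡ 0 → roundOdd n ≡ suc (roundEven n)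
roundOdd-even n p rewrite [m+n]%2≡[m%2+n%2]%2 n 1 | p = +-suc n 0

roundEven-odd : ∀ n → n % 2 ≡ 1 → roundEven n ≡ suc (roundOdd n)
roundEven-odd n p rewrite [m+n]%2≡[m%2+n%2]%2 n 1 | p = +-suc n 0

termM-zero : ∀ A B → termM 0 A B ≡ nat² (roundEven A) (roundOdd B)
termM-zero A B =
  cong₂ nat² (cong (λ x → A + x % 2) (+-identityʳ A)) (cong (λ x → B + (x + 1) % 2) (+-identityʳ B))

termM-one : ∀ A B → termM 1 A B ≡ nat² (roundOdd A) (roundEven B)
termM-one A B = cong (λ x → nat² (roundOdd A) (B + x)) (trans (cong (_% 2) (+-assoc B 1 1)) ([m+n]%n≡m%n B 2))

IsUnit : ℤ → Set
IsUnit s = s ≡ 1ℤ ⊎ s ≡ -1ℤ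

+[1+m]-+m≡1 : ∀ m → + suc m -ℤ + m ≡ 1ℤ
+[1+m]-+m≡1 m = cancel (+ m)
  where
  cancel : ∀ i → (1ℤ ℤ+ i) -ℤ i ≡ 1ℤ
  cancel = ℤ-Solver.solve-∀

+m-+[1+m]≡-1 : ∀ m → + m -ℤ + suc m ≡ -1ℤ
+m-+[1+m]≡-1 m = cancel (+ m)
  where
  cancel : ∀ i → i -ℤ (1ℤ ℤ+ i) ≡ -1ℤ
  cancel = ℤ-Solver.solve-∀

adjacent⇒difference-isUnit : ∀ {m n} → m ≡ suc n ⊎ n ≡ suc m → IsUnit (+ m -ℤ + n)
adjacent⇒difference-isUnit {n = n} (inj₁ refl) = inj₁ (+[1+m]-+m≡1 n)
adjacent⇒difference-isUnit {m = m} (inj₂ refl) = inj₂ (+m-+[1+m]≡-1 m)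

roundOdd-roundEven-adjacent : ∀ n → roundOdd n ≡ suc (roundEven n) ⊎ roundEven n ≡ suc (roundOdd n)
roundOdd-roundEven-adjacent n with %2-bit n
... | inj₁ p = inj₁ (roundOdd-even n p)
... | inj₂ p = inj₂ (roundEven-odd n p)

gap : ℕ → ℤ
gap n = + roundOdd n -ℤ + roundEven n

gap-isUnit : ∀ n → IsUnit (gap n)
gap-isUnit n = adjacent⇒difference-isUnit (roundOdd-roundEven-adjacent n)

reverseGap-isUnit : ∀ n → IsUnit (+ roundEven n -ℤ + roundOdd n)
reverseGap-isUnit n = adjacent⇒difference-isUnit (swap (roundOdd-roundEven-adjacent n))

gap-even : ∀ n → n % 2 ≡ 0 → gap n ≡ 1ℤ
gap-even n p = trans (cong (λ k → + k -ℤ + roundEven n) (roundOdd-even n p)) (+[1+m]-+m≡1 (roundEven n))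

gap-odd : ∀ n → n % 2 ≡ 1 → gap n ≡ -1ℤ
gap-odd n p = trans (cong (λ k → + roundOdd n -ℤ + k) (roundEven-odd n p)) (+m-+[1+m]≡-1 (roundOdd n))

gap-diagonal : ∀ m n → m % 2 ≡ n % 2 → (gap m , gap n) ≡± (1ℤ , 1ℤ)
gap-diagonal m n h with %2-bit m
... | inj₁ p = inj₁ (cong₂ _,_ (gap-even m p) (gap-even n (trans (sym h) p)))
... | inj₂ p = inj₂ (cong₂ _,_ (gap-odd m p) (gap-odd n (trans (sym h) p)))

gap-antidiagonal : ∀ m n → m % 2 ≢ n % 2 → (gap m , gap n) ≡± (1ℤ , -1ℤ)
gap-antidiagonal m n h with %2-bit m | %2-bit n
... | inj₁ p | inj₁ q = contradiction (trans p (sym q)) h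
... | inj₁ p | inj₂ q = inj₁ (cong₂ _,_ (gap-even m p) (gap-odd n q))
... | inj₂ p | inj₁ q = inj₂ (cong₂ _,_ (gap-odd m p) (gap-even n q))
... | inj₂ p | inj₂ q = contradiction (trans p (sym q)) h

isUnit⇒on-axis₁ : ∀ {s} i → IsUnit s → (s , i -ℤ i) ≡± (1ℤ , 0ℤ)
isUnit⇒on-axis₁ i (inj₁ refl) = inj₁ (cong (1ℤ ,_) (+-inverseʳ i))
isUnit⇒on-axis₁ i (inj₂ refl) = inj₂ (cong (-1ℤ ,_) (+-inverseʳ i))

isUnit⇒on-axis₂ : ∀ {s} i → IsUnit s → (i -ℤ i , s) ≡± (0ℤ , 1ℤ)
isUnit⇒on-axis₂ i (inj₁ refl) = inj₁ (cong (_, 1ℤ) (+-inverseʳ i))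
isUnit⇒on-axis₂ i (inj₂ refl) = inj₂ (cong (_, -1ℤ) (+-inverseʳ i))

nextD-agree-disagree : ∀ D A B → LowBitsAgree A → ¬ LowBitsAgree B → nextD D A B ≡ 0
nextD-agree-disagree D A B hA hB rewrite ≡⇒≡ᵇ≡true hA | ≢⇒≡ᵇ≡false hB = refl

nextD-disagree-agree : ∀ D A B → ¬ LowBitsAgree A → LowBitsAgree B → nextD D A B ≡ 1
nextD-disagree-agree D A B hA hB rewrite ≢⇒≡ᵇ≡false hA | ≡⇒≡ᵇ≡true hB = refl

nextD₀-agree : ∀ A B → LowBitsAgree A → nextD 0 A B ≡ 0
nextD₀-agree A B hA rewrite ≡⇒≡ᵇ≡true hA with B % 2 ≡ᵇ (B / 2) % 2
... | true  = refl
... | false = refl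

nextD₀-disagree : ∀ A B → ¬ LowBitsAgree A → nextD 0 A B ≡ 1
nextD₀-disagree A B hA rewrite ≢⇒≡ᵇ≡false hA with B % 2 ≡ᵇ (B / 2) % 2
... | true  = refl
... | false = refl

nextD₁-agree : ∀ A B → LowBitsAgree B → nextD 1 A B ≡ 1
nextD₁-agree A B hB rewrite ≡⇒≡ᵇ≡true hB with A % 2 ≡ᵇ (A / 2) % 2
... | true  = refl
... | false = refl

nextD₁-disagree : ∀ A B → ¬ LowBitsAgree B → nextD 1 A B ≡ 0
nextD₁-disagree A B hB rewrite ≢⇒≡ᵇ≡false hB with A % 2 ≡ᵇ (A / 2) % 2
... | true  = refl
... | false = refl

lastStep : ℕ → ℕ → ℕ → List ℤ²
lastStep D A B = termO D A B ∷ termE D A B ∷ termM D A B ∷ []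

chainF-suc : ∀ k D A B → ¬ (A ≡ 0 × B ≡ 0) →
  chainF (suc k) D A B ≡ chainF k (nextD D A B) (A / 2) (B / 2) ++ lastStep D A B
chainF-suc k D zero    zero    nz = contradiction (refl , refl) nz
chainF-suc k D zero    (suc B) nz = refl
chainF-suc k D (suc A) B       nz = refl

+≡suc : ∀ A B → ¬ (A ≡ 0 × B ≡ 0) → ∃ λ k → A + B ≡ suc k
+≡suc zero    zero    nz = contradiction (refl , refl) nz
+≡suc zero    (suc B) nz = B , refl
+≡suc (suc A) B       nz = A + B , refl

¬halves≡0⇒¬≡0 : ∀ {A B} → ¬ (A / 2 ≡ 0 × B / 2 ≡ 0) → ¬ (A ≡ 0 × B ≡ 0)
¬halves≡0⇒¬≡0 h (refl , refl) = h (refl , refl)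

chain-lastTwoSteps : ∀ D A B → ¬ (A / 2 ≡ 0 × B / 2 ≡ 0) → ∃ λ pre →
  chain D A B ≡ pre ++ lastStep (nextD D A B) (A / 2) (B / 2) ++ lastStep D A B
chain-lastTwoSteps D A B h with +≡suc A B (¬halves≡0⇒¬≡0 h)
... | k , A+B≡1+k = chainF k (nextD d a b) (a / 2) (b / 2) , (begin
    chainF (suc (A + B)) D A B               ≡⟨ chainF-suc (A + B) D A B (¬halves≡0⇒¬≡0 h) ⟩
    chainF (A + B) d a b ++ lastStep D A B   ≡⟨ cong (λ n → chainF n d a b ++ lastStep D A B) A+B≡1+k ⟩
    chainF (suc k) d a b ++ lastStep D A B   ≡⟨ cong (_++ lastStep D A B) (chainF-suc k d a b h) ⟩
    (chainF k (nextD d a b) (a / 2) (b / 2) ++ lastStep d a b) ++ lastStep D A B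
      ≡⟨ ++-assoc (chainF k (nextD d a b) (a / 2) (b / 2)) (lastStep d a b) (lastStep D A B) ⟩
    chainF k (nextD d a b) (a / 2) (b / 2) ++ lastStep d a b ++ lastStep D A B ∎)
  where
  a b d : ℕ
  a = A / 2
  b = B / 2
  d = nextD D A B

DifferentialSum : ℕ → ℤ² → ℤ² → ℤ² → Set
DifferentialSum D M u v =
  (M ≡ u ⊕ v) × (D ≡ 0 → (u ⊖ v) ≡± (0ℤ , 1ℤ)) × (D ≡ 1 → (u ⊖ v) ≡± (1ℤ , 0ℤ))

DifferentialSum-cong : ∀ {D M M′ u u′} v → M ≡ M′ → u ≡ u′ →
  DifferentialSum D M′ u′ v → DifferentialSum D M u v
DifferentialSum-cong _ refl refl s = s

module _ (A B : ℕ) where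

  private
    a b : ℕ
    a = A / 2
    b = B / 2

  termM₀≡termM⊕termE : LowBitsAgree A →
    DifferentialSum 0 (termM 0 A B) (termM (nextD 0 A B) a b) (termE (nextD 0 A B) a b)
  termM₀≡termM⊕termE hA rewrite nextD₀-agree A B hA =
    DifferentialSum-cong (termE 0 a b) (termM-zero A B) (termM-zero a b)
      ( cong₂ nat² (roundEven-halve-agree A hA) (roundOdd-halve B)
      , (λ _ → isUnit⇒on-axis₂ (+ roundEven a) (gap-isUnit b)) , λ ())

  termM₁≡termM⊕termE : LowBitsAgree B →
    DifferentialSum 1 (termM 1 A B) (termM (nextD 1 A B) a b) (termE (nextD 1 A B) a b)
  termM₁≡termM⊕termE hB rewrite nextD₁-agree A B hB =
    DifferentialSum-cong (termE 1 a b) (termM-one A B) (termM-one a b)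
      ( cong₂ nat² (roundOdd-halve A) (roundEven-halve-agree B hB)
      , (λ ()) , (λ _ → isUnit⇒on-axis₁ (+ roundEven b) (gap-isUnit a)))

  termM₀≡termM⊕termO : ¬ LowBitsAgree A →
    DifferentialSum 0 (termM 0 A B) (termM (nextD 0 A B) a b) (termO (nextD 0 A B) a b)
  termM₀≡termM⊕termO hA rewrite nextD₀-disagree A B hA =
    DifferentialSum-cong (termO 1 a b) (termM-zero A B) (termM-one a b)
      ( cong₂ nat² (roundEven-halve-disagree A hA)
                   (trans (roundOdd-halve B) (+-comm (roundOdd b) (roundEven b)))
      , (λ _ → isUnit⇒on-axis₂ (+ roundOdd a) (reverseGap-isUnit b)) , λ ())

  termM₁≡termM⊕termO : ¬ LowBitsAgree B →
    DifferentialSum 1 (termM 1 A B) (termM (nextD 1 A B) a b) (termO (nextD 1 A B) a b)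
  termM₁≡termM⊕termO hB rewrite nextD₁-disagree A B hB =
    DifferentialSum-cong (termO 0 a b) (termM-one A B) (termM-zero a b)
      ( cong₂ nat² (trans (roundOdd-halve A) (+-comm (roundOdd a) (roundEven a)))
                   (roundEven-halve-disagree B hB)
      , (λ ()) , (λ _ → isUnit⇒on-axis₁ (+ roundOdd b) (reverseGap-isUnit a)))

parityTriple : ℕ → ℕ → ℕ → ℕ × ℕ × ℕ
parityTriple A B D = ⟨ (A ∸ A / 2) % 2 , (B ∸ B / 2) % 2 , D ⟩

termM≡termM⊕termE : ∀ A B D →
  parityTriple A B D ≡ ⟨ 0 , 0 , 0 ⟩ ⊎ parityTriple A B D ≡ ⟨ 0 , 0 , 1 ⟩
    ⊎ parityTriple A B D ≡ ⟨ 0 , 1 , 0 ⟩ ⊎ parityTriple A B D ≡ ⟨ 1 , 0 , 1 ⟩ →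
  DifferentialSum D (termM D A B)
    (termM (nextD D A B) (A / 2) (B / 2)) (termE (nextD D A B) (A / 2) (B / 2))
termM≡termM⊕termE A B D (inj₁ p) with ⟨⟩-injective p
... | α≡0 , _ , refl = termM₀≡termM⊕termE A B ([n∸n/2]%2≡0⇒agree A α≡0)
termM≡termM⊕termE A B D (inj₂ (inj₁ p)) with ⟨⟩-injective p
... | _ , β≡0 , refl = termM₁≡termM⊕termE A B ([n∸n/2]%2≡0⇒agree B β≡0)
termM≡termM⊕termE A B D (inj₂ (inj₂ (inj₁ p))) with ⟨⟩-injective p
... | α≡0 , _ , refl = termM₀≡termM⊕termE A B ([n∸n/2]%2≡0⇒agree A α≡0)
termM≡termM⊕termE A B D (inj₂ (inj₂ (inj₂ p))) with ⟨⟩-injective p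
... | _ , β≡0 , refl = termM₁≡termM⊕termE A B ([n∸n/2]%2≡0⇒agree B β≡0)

termM≡termM⊕termO : ∀ A B D →
  parityTriple A B D ≡ ⟨ 0 , 1 , 1 ⟩ ⊎ parityTriple A B D ≡ ⟨ 1 , 0 , 0 ⟩
    ⊎ parityTriple A B D ≡ ⟨ 1 , 1 , 0 ⟩ ⊎ parityTriple A B D ≡ ⟨ 1 , 1 , 1 ⟩ →
  DifferentialSum D (termM D A B)
    (termM (nextD D A B) (A / 2) (B / 2)) (termO (nextD D A B) (A / 2) (B / 2))
termM≡termM⊕termO A B D (inj₁ p) with ⟨⟩-injective p
... | _ , β≡1 , refl = termM₁≡termM⊕termO A B ([n∸n/2]%2≡1⇒disagree B β≡1)
termM≡termM⊕termO A B D (inj₂ (inj₁ p)) with ⟨⟩-injective p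
... | α≡1 , _ , refl = termM₀≡termM⊕termO A B ([n∸n/2]%2≡1⇒disagree A α≡1)
termM≡termM⊕termO A B D (inj₂ (inj₂ (inj₁ p))) with ⟨⟩-injective p
... | α≡1 , _ , refl = termM₀≡termM⊕termO A B ([n∸n/2]%2≡1⇒disagree A α≡1)
termM≡termM⊕termO A B D (inj₂ (inj₂ (inj₂ p))) with ⟨⟩-injective p
... | _ , β≡1 , refl = termM₁≡termM⊕termO A B ([n∸n/2]%2≡1⇒disagree B β≡1)

termE≡two·termM : ∀ A B D →
  (LowBitsAgree A × ¬ LowBitsAgree B) ⊎ (¬ LowBitsAgree A × LowBitsAgree B) →
  termE D A B ≡ two· (termM (nextD D A B) (A / 2) (B / 2))
termE≡two·termM A B D (inj₁ (hA , hB)) rewrite nextD-agree-disagree D A B hA hB =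
  trans (cong₂ nat² (roundEven-halve-agree A hA) (roundEven-halve-disagree B hB))
        (cong two· (sym (termM-zero (A / 2) (B / 2))))
termE≡two·termM A B D (inj₂ (hA , hB)) rewrite nextD-disagree-agree D A B hA hB =
  trans (cong₂ nat² (roundEven-halve-disagree A hA) (roundEven-halve-agree B hB))
        (cong two· (sym (termM-one (A / 2) (B / 2))))

lemma2 : (A B D : ℕ) → D < 2 → ¬ ((A / 2 ≡ 0) × (B / 2 ≡ 0)) →
    (pre : List ℤ²) (o e m O E M : ℤ²) →
    chain D A B ≡ pre ++ (o ∷ e ∷ m ∷ O ∷ E ∷ M ∷ []) →
    -- (i)
    ((O ≡ o ⊕ e)
      × ((A / 2) % 2 ≡ (B / 2) % 2 → (o ⊖ e) ≡± (1ℤ , 1ℤ))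
      × ((A / 2) % 2 ≢ (B / 2) % 2 → (o ⊖ e) ≡± (1ℤ , -1ℤ)))
    -- (ii)
    × ((A % 2 ≡ (A / 2) % 2 → B % 2 ≡ (B / 2) % 2 → E ≡ two· e)
      × (((A % 2 ≡ (A / 2) % 2) × (B % 2 ≢ (B / 2) % 2))
          ⊎ ((A % 2 ≢ (A / 2) % 2) × (B % 2 ≡ (B / 2) % 2)) → E ≡ two· m)
      × (A % 2 ≢ (A / 2) % 2 → B % 2 ≢ (B / 2) % 2 → E ≡ two· o))
    -- (iii), with α = (A - a) mod 2 and β' = (B - b) mod 2
    × ((⟨ (A ∸ A / 2) % 2 , (B ∸ B / 2) % 2 , D ⟩ ≡ ⟨ 0 , 0 , 0 ⟩
          ⊎ ⟨ (A ∸ A / 2) % 2 , (B ∸ B / 2) % 2 , D ⟩ ≡ ⟨ 0 , 0 , 1 ⟩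
          ⊎ ⟨ (A ∸ A / 2) % 2 , (B ∸ B / 2) % 2 , D ⟩ ≡ ⟨ 0 , 1 , 0 ⟩
          ⊎ ⟨ (A ∸ A / 2) % 2 , (B ∸ B / 2) % 2 , D ⟩ ≡ ⟨ 1 , 0 , 1 ⟩ →
        (M ≡ m ⊕ e)
          × (D ≡ 0 → (m ⊖ e) ≡± (0ℤ , 1ℤ))
          × (D ≡ 1 → (m ⊖ e) ≡± (1ℤ , 0ℤ)))
      × (⟨ (A ∸ A / 2) % 2 , (B ∸ B / 2) % 2 , D ⟩ ≡ ⟨ 0 , 1 , 1 ⟩
          ⊎ ⟨ (A ∸ A / 2) % 2 , (B ∸ B / 2) % 2 , D ⟩ ≡ ⟨ 1 , 0 , 0 ⟩
          ⊎ ⟨ (A ∸ A / 2) % 2 , (B ∸ B / 2) % 2 , D ⟩ ≡ ⟨ 1 , 1 , 0 ⟩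
          ⊎ ⟨ (A ∸ A / 2) % 2 , (B ∸ B / 2) % 2 , D ⟩ ≡ ⟨ 1 , 1 , 1 ⟩ →
        (M ≡ m ⊕ o)
          × (D ≡ 0 → (m ⊖ o) ≡± (0ℤ , 1ℤ))
          × (D ≡ 1 → (m ⊖ o) ≡± (1ℤ , 0ℤ))))
-- D < 2 is not needed: the case hypotheses of (iii) fix D, and (i), (ii) do not involve it.
lemma2 A B D _ h pre o e m O E M eq with chain-lastTwoSteps D A B h
... | rest , chain≡ with ++-cancelˡ-≡length rest pre refl (trans (sym chain≡) eq)
... | refl =
    ( cong₂ nat² (roundOdd-halve A) (roundOdd-halve B)
    , gap-diagonal (A / 2) (B / 2)
    , gap-antidiagonal (A / 2) (B / 2) )
  , ( (λ hA hB → cong₂ nat² (roundEven-halve-agree A hA) (roundEven-halve-agree B hB))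
    , termE≡two·termM A B D
    , (λ hA hB → cong₂ nat² (roundEven-halve-disagree A hA) (roundEven-halve-disagree B hB)) )
  , ( termM≡termM⊕termE A B D
    , termM≡termM⊕termO A B D )
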